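{- Let $n\ge 1$, $m\ge 2$, and let $T$ be a tiered tree on the vertex set $\{1,\dots,n\}$ with tiering function $t\colon\{1,\dots,n\}\to\{1,\dots,m\}$. Let $K_t$ be the graph on $\{1,\dots,n\}$ whose edges are all pairs $\{v,v'\}$ with $v>v'$ and $t(v)>t(v')$ (so $T$ is a spanning tree of $K_t$). Order the edges of $K_t$ lexicographically, identifying an edge $\{a,b\}$ with $a<b$ with the pair $(a,b)$. Then the weight $w(T)$ equals the external activity of $T$ in $K_t$, i.e. the number of edges $e$ of $K_t$ not in $T$ such that $e$ is the least edge (in this order) of the unique cycle contained in $T\cup\{e\}$.
   Context: A tiered tree with $m\ge 2$ levels is a tree $T$ with vertex set $\{1,\dots,n\}$ (vertices identified with their labels) together with a surjective function $t\colon \{1,\dots,n\}\to\{1,\dots,m\}$ (the tiering function) such that for any adjacent vertices $v,v'$ we have $t(v)\neq t(v')$, and if $v,v'$ are adjacent with $v>v'$ then $t(v)>t(v')$. The weight $w(T)$ is defined recursively (the definition makes sense for trees whose vertices are labeled by any finite set of integers, with a tiering function into an ordered set satisfying the same adjacency condition): if $T$ has a single vertex, $w(T)=0$. Otherwise let $v$ be the vertex with smallest label, and let $T_1,\dots,T_l$ be the connected components of the forest obtained by deleting $v$ (each with the restricted labels and tiering function). For each $i$, let $u_i\in T_i$ be the vertex of $T_i$ adjacent to $v$, and let $w_i$ be the number of vertices $u\in T_i$ with $t(u)>t(v)$ and $u<u_i$. Then $w(T)=\sum_{i=1}^{l}(w_i+w(T_i))$. -}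

module Defs where

open import Data.Bool using (Bool; true; false; _∧_; _∨_; not; if_then_else_; T)
open import Data.Nat using (ℕ; zero; suc; _<_; _≤_; _<ᵇ_)
open import Data.Fin using (Fin; toℕ; _≟_)
open import Data.List using (List; []; _∷_; _++_; [_]; length; map; allFin)
open import Data.Nat.ListAction using (sum)
open import Data.Bool.ListAction using (any)
open import Data.List.Relation.Unary.Linked using (Linked)
open import Data.List.Relation.Unary.Unique.Propositional using (Unique)
open import Data.Maybe using (Maybe; just; nothing)
open import Data.Product using (_×_; _,_; ∃; ∃-syntax)
open import Data.Sum using (_⊎_)
open import Function using (_∘_)
open import Relation.Binary.PropositionalEquality using (_≡_; _≢_)
open import Relation.Nullary using (¬_)
open import Relation.Nullary.Decidable using (⌊_⌋)

-- Conventions: the vertex labelled i (1 ≤ i ≤ n) in the paper is the element of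
-- Fin n with toℕ = i - 1 (labels are compared via toℕ; the shift is order
-- preserving).  Likewise tiers 1..m are Fin m.

Graph : ℕ → Set
Graph n = Fin n → Fin n → Bool

Adj : ∀ {n} → Graph n → Fin n → Fin n → Set
Adj G x y = T (G x y)

IsSimple : ∀ {n} → Graph n → Set
IsSimple {n} G = (∀ x y → G x y ≡ G y x) × (∀ x → G x x ≡ false)

data Walk {n} (G : Graph n) : Fin n → Fin n → Set where
  []  : ∀ {x} → Walk G x x
  _∷_ : ∀ {x y z} → Adj G x y → Walk G y z → Walk G x z

Connected : ∀ {n} → Graph n → Set
Connected {n} G = ∀ (x y : Fin n) → Walk G x y

IsCycle : ∀ {n} → Graph n → List (Fin n) → Set
IsCycle G []       = ⊥'
  where open import Data.Empty using () renaming (⊥ to ⊥')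
IsCycle G (v ∷ vs) = (2 ≤ length vs) × Unique (v ∷ vs) × Linked (Adj G) ((v ∷ vs) ++ [ v ])

Acyclic : ∀ {n} → Graph n → Set
Acyclic {n} G = ∀ (c : List (Fin n)) → ¬ IsCycle G c

IsTree : ∀ {n} → Graph n → Set
IsTree G = IsSimple G × Connected G × Acyclic G

IsTiering : ∀ {n m} → Graph n → (Fin n → Fin m) → Set
IsTiering {n} {m} G t =
    (∀ (j : Fin m) → ∃[ i ] t i ≡ j)
  × (∀ (v v' : Fin n) → Adj G v v' → t v ≢ t v')
  × (∀ (v v' : Fin n) → Adj G v v' → toℕ v' < toℕ v → toℕ (t v') < toℕ (t v))

IsTieredTree : ∀ {n m} → Graph n → (Fin n → Fin m) → Set
IsTieredTree G t = IsTree G × IsTiering G t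

firstTrue : ∀ {n} → (Fin n → Bool) → Maybe (Fin n)
firstTrue {zero}  S = nothing
firstTrue {suc n} S with S Fin.zero
  where import Data.Fin as Fin
... | true  = just Fin.zero
  where import Data.Fin as Fin
... | false = Data.Maybe.map Fin.suc (firstTrue (S ∘ Fin.suc))
  where import Data.Fin as Fin
        import Data.Maybe

count : ∀ {n} → (Fin n → Bool) → ℕ
count {n} S = sum (map (λ x → if S x then 1 else 0) (allFin n))

iter : ∀ {A : Set} → ℕ → (A → A) → A → A
iter zero    f a = a
iter (suc k) f a = f (iter k f a)

-- connected component of u in the subgraph of G induced on S (u ∈ S):
-- n rounds of neighbourhood closure
component : ∀ {n} → Graph n → (Fin n → Bool) → Fin n → (Fin n → Bool)
component {n} G S u = iter n step (λ x → ⌊ x ≟ u ⌋)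
  where
  step : (Fin n → Bool) → (Fin n → Bool)
  step C x = C x ∨ (S x ∧ any (λ y → C y ∧ G x y) (allFin n))

-- Let v be the
-- least vertex of S and S' = S ∖ {v}.  The components T_i of the forest
-- (induced on S') are indexed by the neighbours u_i of v in S' (in a tree
-- each component contains exactly one neighbour of v); T_i is the component
-- of u_i.  w_i counts vertices u of T_i with t(u) > t(v) and u < u_i.
-- A single vertex has no neighbours, so the empty sum gives w = 0.
-- The fuel (number of vertices) bounds the recursion depth.
weightOn : ∀ {n m} → Graph n → (Fin n → Fin m) → ℕ → (Fin n → Bool) → ℕ
weightOn {n} G t zero    S = 0
weightOn {n} G t (suc k) S = go (firstTrue S)
  where
  go : Maybe (Fin n) → ℕ
  go nothing  = 0
  go (just v) = sum (map contrib (allFin n))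
    where
    S' : Fin n → Bool
    S' x = S x ∧ not ⌊ x ≟ v ⌋
    contrib : Fin n → ℕ
    contrib u = if S' u ∧ G v u
                then count (λ x → component G S' u x
                                  ∧ (toℕ (t v) <ᵇ toℕ (t x))
                                  ∧ (toℕ x <ᵇ toℕ u))
                     Data.Nat.+ weightOn G t k (component G S' u)
                else 0
      where import Data.Nat

weight : ∀ {n m} → Graph n → (Fin n → Fin m) → ℕ
weight {n} G t = weightOn G t n (λ _ → true)

IsKEdge : ∀ {n m} → (Fin n → Fin m) → Fin n → Fin n → Set
IsKEdge t a b = (toℕ a < toℕ b) × (toℕ (t a) < toℕ (t b))

addEdge : ∀ {n} → Graph n → Fin n → Fin n → Graph n
addEdge G a b x y = G x y ∨ (⌊ x ≟ a ⌋ ∧ ⌊ y ≟ b ⌋) ∨ (⌊ x ≟ b ⌋ ∧ ⌊ y ≟ a ⌋)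

_≤lex_ : ℕ × ℕ → ℕ × ℕ → Set
(a , b) ≤lex (c , d) = (a < c) ⊎ ((a ≡ c) × (b ≤ d))

edgeKey : ∀ {n} → Fin n → Fin n → ℕ × ℕ
edgeKey x y = if toℕ x <ᵇ toℕ y then (toℕ x , toℕ y) else (toℕ y , toℕ x)

CycleEdgesAbove : ∀ {n} → Fin n → Fin n → List (Fin n) → Set
CycleEdgesAbove a b []       = Data.Unit.⊤
  where import Data.Unit
CycleEdgesAbove a b (v ∷ vs) =
  Linked (λ x y → (toℕ a , toℕ b) ≤lex edgeKey x y) ((v ∷ vs) ++ [ v ])

ExternallyActive : ∀ {n m} → Graph n → (Fin n → Fin m) → Fin n → Fin n → Set
ExternallyActive {n} G t a b =
    IsKEdge t a b
  × ¬ Adj G a b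
  × (∀ (c : List (Fin n)) → IsCycle (addEdge G a b) c → CycleEdgesAbove a b c)

HasCount : ∀ {n} → (Fin n → Fin n → Set) → ℕ → Set
HasCount {n} P k =
  ∃[ L ] Unique L × (∀ (a b : Fin n) → ((a , b) ∈ L → P a b) × (P a b → (a , b) ∈ L))
         × length L ≡ k
  where open import Data.List.Membership.Propositional using (_∈_)

externalActivity-is : ∀ {n m} → Graph n → (Fin n → Fin m) → ℕ → Set
externalActivity-is G t k = HasCount (ExternallyActive G t) k

module Submission where

-- Call a pair a < b with t(a) < t(b) and {a,b} ∉ T active in a vertex set S if a ∈ S and the
-- tree path from a to b leaves a through a neighbour N > b and then stays inside S above a.
--
-- For S = all vertices, active pairs are exactly the externally active edges of K_t: the cycle
-- of T ∪ {a,b} is that path closed up by {a,b}, so {a,b} is its least edge iff the path never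
-- drops below a and its first edge {a,N} has N > b. Rather than proving that this cycle is the
-- only one, the edges of an arbitrary cycle are bounded vertex by vertex, using only that T has
-- no detour around a vertex.
--
-- Active pairs also obey the recursion defining w. Let v be the least vertex of a subtree S and
-- T_u the component of S ∖ v containing the neighbour u of v. A pair (v,b) is active iff
-- b ∈ T_u, t(b) > t(v) and b < u for some (necessarily unique) u, which is what w_u counts, and a
-- pair (a,b) with a ≠ v is active in S iff it is active in the component containing a. So the
-- number of active pairs in S is w(S).

open import Defs
open import Data.Bool using (Bool; true; false; _∧_; _∨_; not; if_then_else_; T)
open import Data.Bool.Properties using (T-∧; T-∨)
open import Data.Bool.ListAction using (any)
open import Data.Empty using (⊥-elim)
open import Data.Fin using (Fin; toℕ; _≟_; punchIn; punchOut) renaming (zero to fzero; suc to fsuc)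
open import Data.Fin.Properties using (punchOut-injective; punchInᵢ≢i; toℕ-injective; toℕ<n)
open import Data.List
  using (List; []; _∷_; _++_; [_]; length; map; allFin; filter; cartesianProduct; initLast; _∷ʳ′_)
open import Data.List.Membership.Propositional using (_∈_; lose)
open import Data.List.Membership.Propositional.Properties
  using (∈-allFin; ∈-filter⁺; ∈-filter⁻; ∈-cartesianProduct⁺)
open import Data.List.Properties using (map-tabulate; length-++; ++-assoc; ∷-injectiveʳ; map-++; map-∘)
open import Data.List.Relation.Binary.Permutation.Propositional using (↭⇒↭ₛ)
open import Data.List.Relation.Binary.Permutation.Propositional.Properties using (∷↭∷ʳ)
import Data.List.Relation.Binary.Permutation.Setoid.Properties as Permutation
open import Data.List.Relation.Unary.All as All using (All; []; _∷_)
open import Data.List.Relation.Unary.All.Properties using (¬Any⇒All¬; ++⁻ʳ)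
open import Data.List.Relation.Unary.AllPairs using ([]; _∷_)
open import Data.List.Relation.Unary.Any as Any using (here; there)
open import Data.List.Relation.Unary.Any.Properties using (any⁺; any⁻)
open import Data.List.Relation.Unary.Linked using (Linked; []; [-]; _∷_)
open import Data.List.Relation.Unary.Unique.Propositional using (Unique)
open import Data.List.Relation.Unary.Unique.Propositional.Properties using (filter⁺; cartesianProduct⁺; allFin⁺)
open import Data.Maybe using (just; nothing)
open import Data.Nat using (ℕ; zero; suc; _+_; _∸_; _≤_; _<_; _<ᵇ_; _<?_; z≤n; s≤s)
open import Data.Nat.ListAction using () renaming (sum to sumˡ)
open import Data.Nat.ListAction.Properties using (sum-++)
open import Data.Nat.Properties
  using (+-comm; +-identityʳ; +-suc; +-monoˡ-≤; ≤-trans; ≤-reflexive; n≤1+n; m≤n+m; m∸n+n≡m;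
         <-trans; <-≤-trans; ≤-<-trans; <-irrefl; <⇒≤; <⇒≱; ≮⇒≥; ≤∧≢⇒<; m≤n⇒m<n∨m≡n; <ᵇ⇒<; <⇒<ᵇ;
         +-*-semiring)
open import Algebra.Properties.Semiring.Sum +-*-semiring
  using (sum; sum-cong-≗; sum-remove; sum-replicate-zero; ∑-distrib-+; ∑-comm)
open import Data.Product using (_×_; _,_; proj₁; proj₂; ∃-syntax; swap; uncurry)
open import Data.Sum using (_⊎_; inj₁; inj₂)
open import Data.Unit using (⊤; tt)
open import Function using (_∘_; _⇔_; Equivalence; mk⇔)
open import Function.Properties.Equivalence using () renaming (trans to ⇔-trans; sym to ⇔-sym)
open import Relation.Binary.Definitions using (Symmetric)
open import Relation.Binary.PropositionalEquality
  using (_≡_; _≢_; refl; sym; trans; cong; cong₂; subst; ≢-sym; setoid; module ≡-Reasoning)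
open import Relation.Nullary using (¬_; yes; no)
open import Relation.Nullary.Decidable using (⌊_⌋; toWitness; fromWitness; T?)

open Equivalence using (to; from)

∧⁻ : ∀ {x y} → T (x ∧ y) → T x × T y
∧⁻ = to T-∧

∧⁺ : ∀ {x y} → T x → T y → T (x ∧ y)
∧⁺ p q = from T-∧ (p , q)

∨-introˡ : ∀ {x y} → T x → T (x ∨ y)
∨-introˡ = from T-∨ ∘ inj₁

∨-introʳ : ∀ x {y} → T y → T (x ∨ y)
∨-introʳ x = from (T-∨ {x}) ∘ inj₂

T-not⇔¬T : ∀ {x} → T (not x) ⇔ (¬ T x)
T-not⇔¬T {true}  = mk⇔ (λ ()) (λ ¬t → ¬t tt)
T-not⇔¬T {false} = mk⇔ (λ _ ()) (λ _ → tt)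

≟-refl : ∀ {n} (x : Fin n) → T ⌊ x ≟ x ⌋
≟-refl x = fromWitness {a? = x ≟ x} refl

≟-sound : ∀ {n} {x y : Fin n} → T ⌊ x ≟ y ⌋ → x ≡ y
≟-sound {x = x} {y} = toWitness {a? = x ≟ y}

>⇒≢ : ∀ {n} {x y : Fin n} → toℕ y < toℕ x → x ≢ y
>⇒≢ y<x x≡y = <-irrefl (cong toℕ (sym x≡y)) y<x

𝟙 : Bool → ℕ
𝟙 b = if b then 1 else 0

𝟙-false : ∀ {b} → ¬ T b → 𝟙 b ≡ 0
𝟙-false {true}  ¬t = ⊥-elim (¬t tt)
𝟙-false {false} _  = refl

if-+ : ∀ c x y → (if c then x else 0) + (if c then y else 0) ≡ (if c then x + y else 0)
if-+ true  x y = refl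
if-+ false x y = refl

sumˡ-allFin : ∀ {n} (f : Fin n → ℕ) → sumˡ (map f (allFin n)) ≡ sum f
sumˡ-allFin {zero}  f = refl
sumˡ-allFin {suc n} f = cong (f fzero +_)
  (trans (cong sumˡ (trans (map-tabulate fsuc f) (sym (map-tabulate (λ i → i) (f ∘ fsuc)))))
         (sumˡ-allFin (f ∘ fsuc)))

∑-zero : ∀ {n} {f : Fin n → ℕ} → (∀ i → f i ≡ 0) → sum f ≡ 0
∑-zero {n} f≡0 = trans (sum-cong-≗ f≡0) (sum-replicate-zero n)

∑-single : ∀ {n} (f : Fin n → ℕ) (i : Fin n) → (∀ j → j ≢ i → f j ≡ 0) → sum f ≡ f i
∑-single {suc n} f i f≡0 = trans (sum-remove {i = i} f)
  (trans (cong (f i +_) (∑-zero (λ j → f≡0 (punchIn i j) (punchInᵢ≢i i j)))) (+-identityʳ (f i)))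

∑-if : ∀ {n} c (f : Fin n → ℕ) → sum (λ i → if c then f i else 0) ≡ (if c then sum f else 0)
∑-if     true  f = refl
∑-if {n} false f = ∑-zero {n} (λ _ → refl)

∑𝟙-∧ : ∀ {n} c (f : Fin n → Bool) → sum (λ i → 𝟙 (c ∧ f i)) ≡ (if c then sum (𝟙 ∘ f) else 0)
∑𝟙-∧     true  f = refl
∑𝟙-∧ {n} false f = ∑-zero {n} (λ _ → refl)

∑-if-≟ : ∀ {n} (v : Fin n) c → sum (λ i → if ⌊ i ≟ v ⌋ then c else 0) ≡ c
∑-if-≟ v c = trans (∑-single _ v off-v) at-v
  where
  off-v : ∀ i → i ≢ v → (if ⌊ i ≟ v ⌋ then c else 0) ≡ 0
  off-v i i≢v with i ≟ v
  ... | yes i≡v = ⊥-elim (i≢v i≡v)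
  ... | no _    = refl
  at-v : (if ⌊ v ≟ v ⌋ then c else 0) ≡ c
  at-v with v ≟ v
  ... | yes _  = refl
  ... | no v≢v = ⊥-elim (v≢v refl)

𝟙-∃! : ∀ {n} c (B : Fin n → Bool) → (T c ⇔ (∃[ i ] T (B i))) → (∀ {i j} → T (B i) → T (B j) → i ≡ j) →
       𝟙 c ≡ sum (𝟙 ∘ B)
𝟙-∃! true  B c⇔∃ unique with i , bi ← to c⇔∃ _ =
  sym (trans (∑-single (𝟙 ∘ B) i (λ j j≢i → 𝟙-false (λ bj → j≢i (unique bj bi)))) (𝟙-true bi))
  where
  𝟙-true : ∀ {b} → T b → 𝟙 b ≡ 1
  𝟙-true {true} _ = refl
𝟙-∃! false B c⇔∃ unique = sym (∑-zero (λ j → 𝟙-false (λ bj → from c⇔∃ (j , bj))))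

length-filter-T? : ∀ {A : Set} (p : A → Bool) xs → length (filter (T? ∘ p) xs) ≡ sumˡ (map (𝟙 ∘ p) xs)
length-filter-T? p []       = refl
length-filter-T? p (x ∷ xs) with p x
... | true  = cong suc (length-filter-T? p xs)
... | false = length-filter-T? p xs

sumˡ-cartesianProduct : ∀ {A B : Set} (f : A × B → ℕ) xs ys →
  sumˡ (map f (cartesianProduct xs ys)) ≡ sumˡ (map (λ x → sumˡ (map (λ y → f (x , y)) ys)) xs)
sumˡ-cartesianProduct f []       ys = refl
sumˡ-cartesianProduct f (x ∷ xs) ys = begin
  sumˡ (map f (map (x ,_) ys ++ cartesianProduct xs ys))
    ≡⟨ cong sumˡ (map-++ f (map (x ,_) ys) (cartesianProduct xs ys)) ⟩
  sumˡ (map f (map (x ,_) ys) ++ map f (cartesianProduct xs ys))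
    ≡⟨ sum-++ (map f (map (x ,_) ys)) (map f (cartesianProduct xs ys)) ⟩
  sumˡ (map f (map (x ,_) ys)) + sumˡ (map f (cartesianProduct xs ys))
    ≡⟨ cong₂ _+_ (cong sumˡ (sym (map-∘ ys))) (sumˡ-cartesianProduct f xs ys) ⟩
  sumˡ (map (λ y → f (x , y)) ys) + sumˡ (map (λ x → sumˡ (map (λ y → f (x , y)) ys)) xs) ∎
  where open ≡-Reasoning

hasCount-∑𝟙 : ∀ {n} {P : Fin n → Fin n → Set} (p : Fin n → Fin n → Bool) → (∀ a b → T (p a b) ⇔ P a b) →
              HasCount P (sum (λ a → sum (λ b → 𝟙 (p a b))))
hasCount-∑𝟙 {n} p p⇔P =
  filter (T? ∘ uncurry p) pairs ,
  filter⁺ (T? ∘ uncurry p) (cartesianProduct⁺ (allFin⁺ n) (allFin⁺ n)) ,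
  (λ a b → (to (p⇔P a b) ∘ proj₂ ∘ ∈-filter⁻ (T? ∘ uncurry p) {xs = pairs}) ,
           (∈-filter⁺ (T? ∘ uncurry p) (∈-cartesianProduct⁺ (∈-allFin a) (∈-allFin b)) ∘ from (p⇔P a b))) ,
  (begin
    length (filter (T? ∘ uncurry p) pairs)
      ≡⟨ length-filter-T? (uncurry p) pairs ⟩
    sumˡ (map (𝟙 ∘ uncurry p) pairs)
      ≡⟨ sumˡ-cartesianProduct (𝟙 ∘ uncurry p) (allFin n) (allFin n) ⟩
    sumˡ (map row (allFin n))
      ≡⟨ sumˡ-allFin row ⟩
    sum row
      ≡⟨ sum-cong-≗ (λ a → sumˡ-allFin (λ b → 𝟙 (p a b))) ⟩
    sum (λ a → sum (λ b → 𝟙 (p a b))) ∎)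
  where
  open ≡-Reasoning
  pairs : List (Fin n × Fin n)
  pairs = cartesianProduct (allFin n) (allFin n)
  row : Fin n → ℕ
  row a = sumˡ (map (λ b → 𝟙 (p a b)) (allFin n))

Unique⇒length≤ : ∀ {n} (xs : List (Fin n)) → Unique xs → length xs ≤ n
Unique⇒length≤ {zero}  []       _ = z≤n
Unique⇒length≤ {suc n} []       _ = z≤n
Unique⇒length≤ {suc n} (x ∷ xs) (x∉xs ∷ u) =
  s≤s (subst (_≤ n) (length-punchOuts xs x∉xs) (Unique⇒length≤ (punchOuts xs x∉xs) (punchOuts-unique xs x∉xs u)))
  where
  punchOuts : ∀ ys → All (x ≢_) ys → List (Fin n)
  punchOuts []       []         = []
  punchOuts (y ∷ ys) (x≢y ∷ ps) = punchOut x≢y ∷ punchOuts ys ps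

  length-punchOuts : ∀ ys ps → length (punchOuts ys ps) ≡ length ys
  length-punchOuts []       []       = refl
  length-punchOuts (y ∷ ys) (_ ∷ ps) = cong suc (length-punchOuts ys ps)

  punchOuts-∉ : ∀ {y} (x≢y : x ≢ y) ys ps → All (y ≢_) ys → All (punchOut x≢y ≢_) (punchOuts ys ps)
  punchOuts-∉ x≢y []       []         []         = []
  punchOuts-∉ x≢y (z ∷ zs) (x≢z ∷ ps) (y≢z ∷ qs) =
    (y≢z ∘ punchOut-injective x≢y x≢z) ∷ punchOuts-∉ x≢y zs ps qs

  punchOuts-unique : ∀ ys ps → Unique ys → Unique (punchOuts ys ps)
  punchOuts-unique []       []         []         = []
  punchOuts-unique (y ∷ ys) (x≢y ∷ ps) (y∉ys ∷ u) = punchOuts-∉ x≢y ys ps y∉ys ∷ punchOuts-unique ys ps u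

module _ {A : Set} {R : A → A → Set} where

  linked-++[]⁺ : ∀ xs {p q} → Linked R (xs ++ [ p ]) → R p q → Linked R ((xs ++ [ p ]) ++ [ q ])
  linked-++[]⁺ []           _          r = r ∷ [-]
  linked-++[]⁺ (_ ∷ [])     (r′ ∷ [-]) r = r′ ∷ r ∷ [-]
  linked-++[]⁺ (_ ∷ y ∷ xs) (r′ ∷ rs)  r = r′ ∷ linked-++[]⁺ (y ∷ xs) rs r

  linked-++[]⁻ : ∀ xs {p q} → Linked R ((xs ++ [ p ]) ++ [ q ]) → Linked R (xs ++ [ p ]) × R p q
  linked-++[]⁻ []           (r ∷ [-]) = [-] , r
  linked-++[]⁻ (_ ∷ [])     (r′ ∷ rs) = r′ ∷ [-] , proj₂ (linked-++[]⁻ [] rs)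
  linked-++[]⁻ (_ ∷ y ∷ xs) (r′ ∷ rs) = r′ ∷ proj₁ (linked-++[]⁻ (y ∷ xs) rs) , proj₂ (linked-++[]⁻ (y ∷ xs) rs)

  pairs⇒linked : ∀ xs → (∀ pre {x y} post → xs ≡ pre ++ x ∷ y ∷ post → R x y) → Linked R xs
  pairs⇒linked []           _     = []
  pairs⇒linked (_ ∷ [])     _     = [-]
  pairs⇒linked (x ∷ y ∷ xs) pairs =
    pairs [] xs refl ∷ pairs⇒linked (y ∷ xs) (λ pre post eq → pairs (x ∷ pre) post (cong (x ∷_) eq))

-- Walks, paths and cycles

module _ {n : ℕ} (G : Graph n) where

  infixr 5 _∷⟨_⟩_

  data WalkWithin (P : Fin n → Set) : Fin n → Fin n → Set where
    end    : ∀ {x} → P x → WalkWithin P x x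
    _∷⟨_⟩_ : ∀ {x y z} → P x → Adj G x y → WalkWithin P y z → WalkWithin P x z

  data Path : Fin n → Fin n → List (Fin n) → Set where
    []  : ∀ {x} → Path x x []
    _∷_ : ∀ {x y z ys} → Adj G x y → Path y z ys → Path x z (y ∷ ys)

module _ {n : ℕ} {G : Graph n} where

  fromWalk : ∀ {x y} → Walk G x y → WalkWithin G (λ _ → ⊤) x y
  fromWalk []      = end tt
  fromWalk (e ∷ w) = tt ∷⟨ e ⟩ fromWalk w

  path⇒linked : ∀ {x y z ys} → Path G x y ys → Adj G y z → Linked (Adj G) (x ∷ ys ++ [ z ])
  path⇒linked []      e′ = e′ ∷ [-]
  path⇒linked (e ∷ p) e′ = e ∷ path⇒linked p e′

  path-end-∈ : ∀ {x y z zs} → Path G x y (z ∷ zs) → y ∈ z ∷ zs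
  path-end-∈ (_ ∷ [])    = here refl
  path-end-∈ (_ ∷ e ∷ p) = there (path-end-∈ (e ∷ p))

  mapPath : ∀ {G′ : Graph n} {x y ys} → (∀ {u w} → Adj G u w → Adj G′ u w) → Path G x y ys → Path G′ x y ys
  mapPath f []      = []
  mapPath f (e ∷ p) = f e ∷ mapPath f p

  rotate : ∀ {x y r} → IsCycle G (x ∷ y ∷ r) → IsCycle G (y ∷ r ++ [ x ])
  rotate {x} {y} {r} (2≤ , unique , e ∷ es) =
    subst (2 ≤_) (sym (trans (length-++ r) (+-comm (length r) 1))) 2≤ ,
    Permutation.Unique-resp-↭ (setoid _) (↭⇒↭ₛ (∷↭∷ʳ x (y ∷ r))) unique ,
    linked-++[]⁺ (y ∷ r) es e

  rotation-at : ∀ {v vs} → IsCycle G (v ∷ vs) → ∀ pre {x y} post → v ∷ vs ++ [ v ] ≡ pre ++ x ∷ y ∷ post →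
                ∃[ r ] IsCycle G (x ∷ y ∷ r)
  rotation-at {vs = []}    (() , _)
  rotation-at {vs = w ∷ r} c []        _    refl = r , c
  rotation-at {vs = w ∷ r} c (_ ∷ pre) post eq   =
    rotation-at (rotate c) pre (post ++ [ w ]) (trans (cong (_++ [ w ]) (∷-injectiveʳ eq)) (++-assoc pre _ [ w ]))

  cycle-edges-linked : ∀ {Q : Fin n → Fin n → Set} → (∀ {x y r} → IsCycle G (x ∷ y ∷ r) → Q x y) →
                       ∀ {v vs} → IsCycle G (v ∷ vs) → Linked Q (v ∷ vs ++ [ v ])
  cycle-edges-linked edge c = pairs⇒linked _ (λ pre post eq → edge (proj₂ (rotation-at c pre post eq)))

module _ {n : ℕ} {G : Graph n} {P : Fin n → Set} where

  walk-start : ∀ {x y} → WalkWithin G P x y → P x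
  walk-start (end px)      = px
  walk-start (px ∷⟨ _ ⟩ _) = px

  walk-end : ∀ {x y} → WalkWithin G P x y → P y
  walk-end (end py)     = py
  walk-end (_ ∷⟨ _ ⟩ w) = walk-end w

  infixr 5 _++ʷ_

  _++ʷ_ : ∀ {x y z} → WalkWithin G P x y → WalkWithin G P y z → WalkWithin G P x z
  end _         ++ʷ w′ = w′
  (px ∷⟨ e ⟩ w) ++ʷ w′ = px ∷⟨ e ⟩ (w ++ʷ w′)

  mapʷ : ∀ {Q : Fin n → Set} {x y} → (∀ {z} → P z → Q z) → WalkWithin G P x y → WalkWithin G Q x y
  mapʷ f (end px)      = end (f px)
  mapʷ f (px ∷⟨ e ⟩ w) = f px ∷⟨ e ⟩ mapʷ f w

  reverseʷ : Symmetric (Adj G) → ∀ {x y} → WalkWithin G P x y → WalkWithin G P y x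
  reverseʷ G-sym (end px)      = end px
  reverseʷ G-sym (px ∷⟨ e ⟩ w) = reverseʷ G-sym w ++ʷ (walk-start w ∷⟨ G-sym e ⟩ end px)

  linked⇒walk : ∀ {x y} zs → Linked (Adj G) (x ∷ zs ++ [ y ]) → All P (x ∷ zs ++ [ y ]) → WalkWithin G P x y
  linked⇒walk []       (e ∷ [-]) (px ∷ py ∷ []) = px ∷⟨ e ⟩ end py
  linked⇒walk (z ∷ zs) (e ∷ es)  (px ∷ ps)      = px ∷⟨ e ⟩ linked⇒walk zs es ps

  SimplePath : Fin n → Fin n → Set
  SimplePath x y = ∃[ xs ] Path G x y xs × Unique (x ∷ xs) × All P (x ∷ xs)

  private
    path-from-∈ : ∀ {x y z ys} → Path G y z ys → x ∈ y ∷ ys → Unique (y ∷ ys) → All P (y ∷ ys) →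
                  SimplePath x z
    path-from-∈ p       (here refl) u       ps       = _ , p , u , ps
    path-from-∈ (_ ∷ p) (there x∈)  (_ ∷ u) (_ ∷ ps) = path-from-∈ p x∈ u ps

  walk⇒path : ∀ {x y} → WalkWithin G P x y → SimplePath x y
  walk⇒path (end px) = [] , [] , [] ∷ [] , px ∷ []
  walk⇒path (_∷⟨_⟩_ {x = x} {y = y} px e w)
    with ys , p , u , ps ← walk⇒path w with Any.any? (x ≟_) (y ∷ ys)
  ... | yes x∈ = path-from-∈ p x∈ u ps
  ... | no x∉  = y ∷ ys , e ∷ p , ¬Any⇒All¬ _ x∉ ∷ u , px ∷ ps

acyclic⇒no-detour : ∀ {n} {G : Graph n} → Symmetric (Adj G) → Acyclic G →
  ∀ {x y y′} → Adj G x y → Adj G x y′ → y ≢ y′ → ¬ WalkWithin G (_≢ x) y y′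
acyclic⇒no-detour G-sym acyclic {x} e e′ y≢y′ w with walk⇒path w
... | []      , []     , _      = y≢y′ refl
... | y₂ ∷ ys , e₂ ∷ p , u , x∉ =
  acyclic (x ∷ _ ∷ y₂ ∷ ys) (s≤s (s≤s z≤n) , All.map ≢-sym x∉ ∷ u , e ∷ path⇒linked (e₂ ∷ p) (G-sym e′))

module _ {n : ℕ} (G : Graph n) (S : Fin n → Bool) (u : Fin n) where

  -- component G S u unfolds to stage n.
  private
    grow : (Fin n → Bool) → Fin n → Bool
    grow C x = C x ∨ (S x ∧ any (λ y → C y ∧ G x y) (allFin n))

    stage : ℕ → Fin n → Bool
    stage k = iter k grow (λ x → ⌊ x ≟ u ⌋)

    stage⇒walk : T (S u) → ∀ k {x} → T (stage k x) → WalkWithin G (T ∘ S) x u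
    stage⇒walk su zero    x∈ with refl ← ≟-sound x∈ = end su
    stage⇒walk su (suc k) x∈ with to T-∨ x∈
    ... | inj₁ x∈′   = stage⇒walk su k x∈′
    ... | inj₂ grown with sx , ∃y ← ∧⁻ grown with y , y∈ ← Any.satisfied (any⁻ _ (allFin n) ∃y) =
      sx ∷⟨ proj₂ (∧⁻ y∈) ⟩ stage⇒walk su k (proj₁ (∧⁻ y∈))

    stage-mono : ∀ k j {x} → T (stage k x) → T (stage (j + k) x)
    stage-mono k zero    x∈ = x∈
    stage-mono k (suc j) x∈ = ∨-introˡ (stage-mono k j x∈)

    path⇒stage : ∀ {x xs} → Path G x u xs → All (T ∘ S) (x ∷ xs) → T (stage (length xs) x)
    path⇒stage []                _         = ≟-refl u
    path⇒stage (_∷_ {y = y} e p) (sx ∷ ps) =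
      from T-∨ (inj₂ (∧⁺ sx (any⁺ _ (lose (∈-allFin y) (∧⁺ (path⇒stage p ps) e)))))

  component⇒walk : T (S u) → ∀ {x} → T (component G S u x) → WalkWithin G (T ∘ S) x u
  component⇒walk su = stage⇒walk su n

  walk⇒component : ∀ {x} → WalkWithin G (T ∘ S) x u → T (component G S u x)
  walk⇒component w with xs , p , uniq , ps ← walk⇒path w =
    subst (λ k → T (stage k _)) (m∸n+n≡m |xs|≤n) (stage-mono (length xs) (n ∸ length xs) (path⇒stage p ps))
    where
    |xs|≤n : length xs ≤ n
    |xs|≤n = ≤-trans (n≤1+n _) (Unique⇒length≤ (_ ∷ xs) uniq)

  walk-within-component : T (S u) → ∀ {Q : Fin n → Set} {x y} →
    WalkWithin G (λ z → T (S z) × Q z) x y → T (component G S u y) →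
    WalkWithin G (λ z → T (component G S u z) × Q z) x y
  walk-within-component su (end (_ , qy))        y∈ = end (y∈ , qy)
  walk-within-component su ((sx , qx) ∷⟨ e ⟩ w) y∈ with w′ ← walk-within-component su w y∈ =
    (walk⇒component (sx ∷⟨ e ⟩ component⇒walk su (proj₁ (walk-start w′))) , qx) ∷⟨ e ⟩ w′

EndpointAbove : ℕ × ℕ → ℕ → ℕ → Set
EndpointAbove (a , b) x y = a ≤ x × (x ≡ a → b ≤ y)

≤lex⇔ : ∀ {e x y} → x ≤ y → e ≤lex (x , y) ⇔ (EndpointAbove e x y × EndpointAbove e y x)
≤lex⇔ {a , b} {x} {y} x≤y = mk⇔ ⇒ ⇐
  where
  ⇒ : (a , b) ≤lex (x , y) → EndpointAbove (a , b) x y × EndpointAbove (a , b) y x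
  ⇒ (inj₁ a<x) = (<⇒≤ a<x , λ { refl → ⊥-elim (<-irrefl refl a<x) }) ,
                 (<⇒≤ (<-≤-trans a<x x≤y) , λ { refl → ⊥-elim (<-irrefl refl (<-≤-trans a<x x≤y)) })
  ⇒ (inj₂ (refl , b≤y)) = (≤-reflexive refl , λ _ → b≤y) , (x≤y , λ { refl → b≤y })
  ⇐ : EndpointAbove (a , b) x y × EndpointAbove (a , b) y x → (a , b) ≤lex (x , y)
  ⇐ ((a≤x , x≡a⇒b≤y) , _) with m≤n⇒m<n∨m≡n a≤x
  ... | inj₁ a<x = inj₁ a<x
  ... | inj₂ a≡x = inj₂ (a≡x , x≡a⇒b≤y (sym a≡x))

≤lex-edgeKey⇔ : ∀ {n e} (x y : Fin n) →
  e ≤lex edgeKey x y ⇔ (EndpointAbove e (toℕ x) (toℕ y) × EndpointAbove e (toℕ y) (toℕ x))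
≤lex-edgeKey⇔ {e = e} x y with toℕ x <ᵇ toℕ y in x<ᵇy
... | true  = ≤lex⇔ (<⇒≤ (<ᵇ⇒< (toℕ x) (toℕ y) (subst T (sym x<ᵇy) _)))
... | false = mk⇔ (swap ∘ to y⇔x) (from y⇔x ∘ swap)
  where
  y⇔x : e ≤lex (toℕ y , toℕ x) ⇔ (EndpointAbove e (toℕ y) (toℕ x) × EndpointAbove e (toℕ x) (toℕ y))
  y⇔x = ≤lex⇔ (≮⇒≥ (λ x<y → subst T x<ᵇy (<⇒<ᵇ x<y)))

-- External activity

module ExternalActivity {n : ℕ} (G : Graph n) (G-sym : Symmetric (Adj G)) (acyclic : Acyclic G)
                        (a b : Fin n) (a<b : toℕ a < toℕ b) where

  H : Graph n
  H = addEdge G a b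

  NewEdge : Fin n → Fin n → Set
  NewEdge x y = (x ≡ a × y ≡ b) ⊎ (x ≡ b × y ≡ a)

  EdgeAbove : Fin n → Fin n → Set
  EdgeAbove x y = (toℕ a , toℕ b) ≤lex edgeKey x y

  EndAbove : Fin n → Fin n → Set
  EndAbove x y = EndpointAbove (toℕ a , toℕ b) (toℕ x) (toℕ y)

  a≢b : a ≢ b
  a≢b = ≢-sym (>⇒≢ a<b)

  H-edge-cases : ∀ {x y} → Adj H x y → Adj G x y ⊎ NewEdge x y
  H-edge-cases h with to T-∨ h
  ... | inj₁ g   = inj₁ g
  ... | inj₂ new with to T-∨ new
  ...   | inj₁ ab = inj₂ (inj₁ (≟-sound (proj₁ (∧⁻ ab)) , ≟-sound (proj₂ (∧⁻ ab))))
  ...   | inj₂ ba = inj₂ (inj₂ (≟-sound (proj₁ (∧⁻ ba)) , ≟-sound (proj₂ (∧⁻ ba))))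

  G⊆H : ∀ {x y} → Adj G x y → Adj H x y
  G⊆H = ∨-introˡ

  NewEdge⊆H : ∀ {x y} → NewEdge x y → Adj H x y
  NewEdge⊆H (inj₁ (refl , refl)) = ∨-introʳ (G a b) (∨-introˡ (∧⁺ (≟-refl a) (≟-refl b)))
  NewEdge⊆H (inj₂ (refl , refl)) = ∨-introʳ (G b a) (∨-introʳ (⌊ b ≟ a ⌋ ∧ ⌊ a ≟ b ⌋) (∧⁺ (≟-refl b) (≟-refl a)))

  H-sym : Symmetric (Adj H)
  H-sym h with H-edge-cases h
  ... | inj₁ g                    = G⊆H (G-sym g)
  ... | inj₂ (inj₁ (refl , refl)) = NewEdge⊆H (inj₂ (refl , refl))
  ... | inj₂ (inj₂ (refl , refl)) = NewEdge⊆H (inj₁ (refl , refl))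

  old-edge : ∀ {x y} → Adj H x y → ¬ NewEdge x y → Adj G x y
  old-edge h old with H-edge-cases h
  ... | inj₁ g   = g
  ... | inj₂ new = ⊥-elim (old new)

  edge-at-a : ∀ {y} → Adj H a y → Adj G a y ⊎ y ≡ b
  edge-at-a h with H-edge-cases h
  ... | inj₁ g                = inj₁ g
  ... | inj₂ (inj₁ (_ , y≡b)) = inj₂ y≡b
  ... | inj₂ (inj₂ (a≡b , _)) = ⊥-elim (a≢b a≡b)

  replace-new-edge : ∀ {P : Fin n → Set} → (∀ {u w} → NewEdge u w → WalkWithin G P u w) →
                     ∀ {x y} → WalkWithin H P x y → WalkWithin G P x y
  replace-new-edge fill (end px)      = end px
  replace-new-edge fill (px ∷⟨ h ⟩ w) with H-edge-cases h
  ... | inj₁ g   = px ∷⟨ g ⟩ replace-new-edge fill w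
  ... | inj₂ new = fill new ++ʷ replace-new-edge fill w

  avoiding-a⇒G : ∀ {x y} → WalkWithin H (_≢ a) x y → WalkWithin G (_≢ a) x y
  avoiding-a⇒G (end px)      = end px
  avoiding-a⇒G (px ∷⟨ h ⟩ w) =
    px ∷⟨ old-edge h (λ { (inj₁ (x≡a , _)) → px x≡a ; (inj₂ (_ , y≡a)) → walk-start w y≡a }) ⟩ avoiding-a⇒G w

  module _ {N : Fin n} (aN : Adj G a N) (b<N : toℕ b < toℕ N)
           (N⇝b : WalkWithin G (λ z → toℕ a < toℕ z) N b) where

    private
      no-detour : ∀ {x y y′} → Adj G x y → Adj G x y′ → y ≢ y′ → ¬ WalkWithin G (_≢ x) y y′
      no-detour = acyclic⇒no-detour G-sym acyclic

      a⇝b-avoiding : ∀ {z} → toℕ z < toℕ a → WalkWithin G (_≢ z) a b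
      a⇝b-avoiding z<a = >⇒≢ z<a ∷⟨ aN ⟩ mapʷ (λ a<q → >⇒≢ (<-trans z<a a<q)) N⇝b

      new-edge-avoiding : ∀ {z} → toℕ z < toℕ a → ∀ {u w} → NewEdge u w → WalkWithin G (_≢ z) u w
      new-edge-avoiding z<a (inj₁ (refl , refl)) = a⇝b-avoiding z<a
      new-edge-avoiding z<a (inj₂ (refl , refl)) = reverseʷ G-sym (a⇝b-avoiding z<a)

      -- For a cycle vertex z with cycle neighbours w₁, w₂: if z < a, replacing {a,b} by the tree
      -- path a, N, …, b (which stays above a) turns the rest of the cycle into a detour around z
      -- in G; if z = a and w₁ ∉ {b, N}, the rest of the cycle (followed by b, …, N) is a detour
      -- around a.
      cycle-vertex-above : ∀ {z w₁ w₂} → Adj H z w₁ → Adj H z w₂ → w₁ ≢ w₂ → WalkWithin H (_≢ z) w₁ w₂ →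
                           toℕ a ≤ toℕ z
      cycle-vertex-above {z} h₁ h₂ w₁≢w₂ w with toℕ z <? toℕ a
      ... | no z≮a  = ≮⇒≥ z≮a
      ... | yes z<a = ⊥-elim (no-detour (old h₁) (old h₂) w₁≢w₂ (replace-new-edge (new-edge-avoiding z<a) w))
        where
        old : ∀ {y} → Adj H z y → Adj G z y
        old h = old-edge h λ { (inj₁ (z≡a , _)) → >⇒≢ z<a (sym z≡a)
                             ; (inj₂ (z≡b , _)) → >⇒≢ (<-trans z<a a<b) (sym z≡b) }

      cycle-neighbour-of-a-above : ∀ {z w₁ w₂} → z ≡ a → Adj H z w₁ → Adj H z w₂ → w₁ ≢ w₂ →
                                   WalkWithin H (_≢ z) w₁ w₂ → toℕ b ≤ toℕ w₁
      cycle-neighbour-of-a-above {w₁ = w₁} refl h₁ h₂ w₁≢w₂ w with edge-at-a h₁ | edge-at-a h₂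
      ... | inj₂ refl | _        = ≤-reflexive refl
      ... | inj₁ g₁   | inj₁ g₂  = ⊥-elim (no-detour g₁ g₂ w₁≢w₂ (avoiding-a⇒G w))
      ... | inj₁ g₁   | inj₂ refl with w₁ ≟ N
      ...   | yes refl = <⇒≤ b<N
      ...   | no w₁≢N  = ⊥-elim (no-detour g₁ aN w₁≢N (avoiding-a⇒G w ++ʷ reverseʷ G-sym (mapʷ >⇒≢ N⇝b)))

      cycle-end-above : ∀ {z w₁ w₂} → Adj H z w₁ → Adj H z w₂ → w₁ ≢ w₂ → WalkWithin H (_≢ z) w₁ w₂ →
                        EndAbove z w₁
      cycle-end-above h₁ h₂ w₁≢w₂ w =
        cycle-vertex-above h₁ h₂ w₁≢w₂ w , λ z≡a → cycle-neighbour-of-a-above (toℕ-injective z≡a) h₁ h₂ w₁≢w₂ w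

      cycle-neighbours-above : ∀ {z w r p} → IsCycle H (z ∷ w ∷ r ++ [ p ]) → EndAbove z w × EndAbove z p
      cycle-neighbours-above {z} {w} {r} {p} (_ , (z∉ ∷ w∉ ∷ _) , zw ∷ es) =
        cycle-end-above zw pz w≢p w⇝p , cycle-end-above pz zw (≢-sym w≢p) (reverseʷ H-sym w⇝p)
        where
        pz : Adj H z p
        pz = H-sym (proj₂ (linked-++[]⁻ (w ∷ r) es))
        w≢p : w ≢ p
        w≢p = All.head (++⁻ʳ r w∉)
        w⇝p : WalkWithin H (_≢ z) w p
        w⇝p = linked⇒walk r (proj₁ (linked-++[]⁻ (w ∷ r) es)) (All.map ≢-sym z∉)

      successor-above : ∀ {z w r} → IsCycle H (z ∷ w ∷ r) → EndAbove z w
      successor-above {r = r} c with initLast r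
      successor-above (s≤s () , _) | []
      ... | _ ∷ʳ′ _ = proj₁ (cycle-neighbours-above c)

      predecessor-above : ∀ {z r p} → IsCycle H (z ∷ r ++ [ p ]) → EndAbove z p
      predecessor-above {r = []}    (s≤s () , _)
      predecessor-above {r = _ ∷ _} c = proj₂ (cycle-neighbours-above c)

      cycle-edge-above : ∀ {x y r} → IsCycle H (x ∷ y ∷ r) → EdgeAbove x y
      cycle-edge-above {x} {y} c = from (≤lex-edgeKey⇔ x y) (successor-above c , predecessor-above (rotate c))

    witness⇒cycles-above : ∀ c → IsCycle H c → CycleEdgesAbove a b c
    witness⇒cycles-above []      ()
    witness⇒cycles-above (_ ∷ _) c = cycle-edges-linked cycle-edge-above c

  private
    EdgeAbove⇒a< : ∀ {x y} → EdgeAbove x y → x ≢ a → toℕ a < toℕ x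
    EdgeAbove⇒a< {x} {y} above x≢a =
      ≤∧≢⇒< (proj₁ (proj₁ (to (≤lex-edgeKey⇔ x y) above))) (λ a≡x → x≢a (toℕ-injective (sym a≡x)))

    path-above-a : ∀ {u zs} → Path G u b zs → Linked EdgeAbove (u ∷ zs ++ [ a ]) → All (_≢ a) (u ∷ zs) →
                   WalkWithin G (λ z → toℕ a < toℕ z) u b
    path-above-a []                _        _          = end a<b
    path-above-a (_∷_ {y = y} e p) (q ∷ qs) (u≢a ∷ us) = EdgeAbove⇒a< {y = y} q u≢a ∷⟨ e ⟩ path-above-a p qs us

  cycles-above⇒witness : Connected G → ¬ Adj G a b → (∀ c → IsCycle H c → CycleEdgesAbove a b c) →
    ∃[ N ] Adj G a N × toℕ b < toℕ N × WalkWithin G (λ z → toℕ a < toℕ z) N b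
  cycles-above⇒witness connected ¬ab above with walk⇒path (fromWalk (connected a b))
  ... | []          , []         , _ = ⊥-elim (a≢b refl)
  ... | _ ∷ []      , ab ∷ []    , _ = ⊥-elim (¬ab ab)
  ... | p₁ ∷ r ∷ rs , ap₁ ∷ path , unique@((a≢p₁ ∷ a∉) ∷ p₁∉ ∷ _) , _
    with q₁ ∷ qs ← above (a ∷ p₁ ∷ r ∷ rs) (s≤s (s≤s z≤n) , unique ,
                     path⇒linked (mapPath G⊆H (ap₁ ∷ path)) (NewEdge⊆H (inj₂ (refl , refl)))) =
    p₁ , ap₁ , ≤∧≢⇒< b≤p₁ (λ b≡p₁ → All.lookup p₁∉ (path-end-∈ path) (toℕ-injective (sym b≡p₁))) ,
    path-above-a path qs (All.map ≢-sym (a≢p₁ ∷ a∉))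
    where
    b≤p₁ : toℕ b ≤ toℕ p₁
    b≤p₁ = proj₂ (proj₁ (to (≤lex-edgeKey⇔ a p₁) q₁)) refl

-- Active pairs

module Activity {n m : ℕ} (G : Graph n) (t : Fin n → Fin m) where

  aboveᵇ : (Fin n → Bool) → Fin n → Fin n → Bool
  aboveᵇ S a z = S z ∧ (toℕ a <ᵇ toℕ z)

  Above : (Fin n → Bool) → Fin n → Fin n → Set
  Above S a z = T (S z) × toℕ a < toℕ z

  Active : (Fin n → Bool) → Fin n → Fin n → Set
  Active S a b = T (S a) × Above S a b × toℕ (t a) < toℕ (t b) × ¬ Adj G a b ×
                 ∃[ N ] Adj G a N × toℕ b < toℕ N × WalkWithin G (Above S a) N b

  leavesTowardsᵇ : (Fin n → Bool) → Fin n → Fin n → Fin n → Bool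
  leavesTowardsᵇ S a b N = G a N ∧ (toℕ b <ᵇ toℕ N) ∧ component G (aboveᵇ S a) b N

  activeᵇ : (Fin n → Bool) → Fin n → Fin n → Bool
  activeᵇ S a b = S a ∧ aboveᵇ S a b ∧ (toℕ (t a) <ᵇ toℕ (t b)) ∧ not (G a b) ∧
                 any (leavesTowardsᵇ S a b) (allFin n)

  aboveᵇ⇔Above : ∀ S a z → T (aboveᵇ S a z) ⇔ Above S a z
  aboveᵇ⇔Above S a z = mk⇔ (λ h → proj₁ (∧⁻ h) , <ᵇ⇒< (toℕ a) (toℕ z) (proj₂ (∧⁻ h)))
                           (λ (sz , a<z) → ∧⁺ sz (<⇒<ᵇ a<z))

  activeᵇ⇔Active : ∀ S a b → T (activeᵇ S a b) ⇔ Active S a b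
  activeᵇ⇔Active S a b = mk⇔ ⇒ ⇐
    where
    ⇒ : T (activeᵇ S a b) → Active S a b
    ⇒ h =
      let sa , h₁ = ∧⁻ h ; ab , h₂ = ∧⁻ h₁ ; tab , h₃ = ∧⁻ h₂ ; ¬ab , h₄ = ∧⁻ h₃
          N , h₅ = Any.satisfied (any⁻ (leavesTowardsᵇ S a b) (allFin n) h₄)
          aN , h₆ = ∧⁻ h₅ ; b<N , N∈ = ∧⁻ h₆
      in sa , to (aboveᵇ⇔Above S a b) ab , <ᵇ⇒< _ _ tab , to T-not⇔¬T ¬ab , N , aN , <ᵇ⇒< _ _ b<N ,
         mapʷ (λ {z} → to (aboveᵇ⇔Above S a z)) (component⇒walk G (aboveᵇ S a) b ab N∈)
    ⇐ : Active S a b → T (activeᵇ S a b)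
    ⇐ (sa , ab , tab , ¬ab , N , aN , b<N , w) =
      ∧⁺ sa (∧⁺ (from (aboveᵇ⇔Above S a b) ab) (∧⁺ (<⇒<ᵇ tab) (∧⁺ (from T-not⇔¬T ¬ab)
        (any⁺ (leavesTowardsᵇ S a b) (lose (∈-allFin N) (∧⁺ aN (∧⁺ (<⇒<ᵇ b<N)
          (walk⇒component G (aboveᵇ S a) b (mapʷ (λ {z} → from (aboveᵇ⇔Above S a z)) w)))))))))

externallyActive⇔Active : ∀ {n m} {G : Graph n} {t : Fin n → Fin m} → Symmetric (Adj G) → Acyclic G →
  Connected G → ∀ a b → ExternallyActive G t a b ⇔ Activity.Active G t (λ _ → true) a b
externallyActive⇔Active {G = G} {t} G-sym acyclic connected a b = mk⇔ ⇒ ⇐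
  where
  open Activity G t
  ⇒ : ExternallyActive G t a b → Active (λ _ → true) a b
  ⇒ ((a<b , tab) , ¬ab , above) =
    let N , aN , b<N , w = ExternalActivity.cycles-above⇒witness G G-sym acyclic a b a<b connected ¬ab above
    in tt , (tt , a<b) , tab , ¬ab , N , aN , b<N , mapʷ (tt ,_) w
  ⇐ : Active (λ _ → true) a b → ExternallyActive G t a b
  ⇐ (_ , (_ , a<b) , tab , ¬ab , N , aN , b<N , w) =
    (a<b , tab) , ¬ab , ExternalActivity.witness⇒cycles-above G G-sym acyclic a b a<b aN b<N (mapʷ proj₂ w)

-- The weight recursion

firstTrue-just : ∀ {n} (S : Fin n → Bool) {v} → firstTrue S ≡ just v →
                 T (S v) × (∀ {x} → T (S x) → toℕ v ≤ toℕ x)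
firstTrue-just {suc n} S eq with S fzero in s₀
firstTrue-just {suc n} S refl | true = subst T (sym s₀) tt , λ _ → z≤n
... | false with firstTrue (S ∘ fsuc) in eq′
firstTrue-just {suc n} S refl | false | just v with sv , v-min ← firstTrue-just (S ∘ fsuc) eq′ =
  sv , λ { {fzero} s → ⊥-elim (subst T s₀ s) ; {fsuc x} s → s≤s (v-min s) }

firstTrue-nothing : ∀ {n} (S : Fin n → Bool) → firstTrue S ≡ nothing → ∀ x → ¬ T (S x)
firstTrue-nothing {suc n} S eq x with S fzero in s₀
firstTrue-nothing {suc n} S () x | true
... | false with firstTrue (S ∘ fsuc) in eq′
firstTrue-nothing {suc n} S refl fzero    | false | nothing = subst T s₀
firstTrue-nothing {suc n} S refl (fsuc x) | false | nothing = firstTrue-nothing (S ∘ fsuc) eq′ x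

module WeightRecursion {n m : ℕ} (G : Graph n) (t : Fin n → Fin m) (G-sym : Symmetric (Adj G))
                       (loopless : ∀ x → ¬ Adj G x x) (acyclic : Acyclic G) where

  open Activity G t

  activeCount : (Fin n → Bool) → ℕ
  activeCount S = sum (λ a → sum (λ b → 𝟙 (activeᵇ S a b)))

  ConnectedOn : (Fin n → Bool) → Set
  ConnectedOn S = ∀ {x y} → T (S x) → T (S y) → WalkWithin G (T ∘ S) x y

  module Step (S : Fin n → Bool) (v : Fin n) (v∈S : T (S v)) (v-min : ∀ {x} → T (S x) → toℕ v ≤ toℕ x)
              (connected : ConnectedOn S) where

    -- S′, nbrᵇ and countedᵇ are literally the local definitions of weightOn, so that weightOn
    -- unfolds to a sum over them; countedᵇ u b says that b is counted by w_i for the T_i ∋ u.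
    S′ : Fin n → Bool
    S′ x = S x ∧ not ⌊ x ≟ v ⌋

    nbrᵇ : Fin n → Bool
    nbrᵇ u = S′ u ∧ G v u

    C : Fin n → Fin n → Bool
    C u = component G S′ u

    countedᵇ : Fin n → Fin n → Bool
    countedᵇ u b = C u b ∧ (toℕ (t v) <ᵇ toℕ (t b)) ∧ (toℕ b <ᵇ toℕ u)

    S′-elim : ∀ {x} → T (S′ x) → T (S x) × x ≢ v
    S′-elim {x} x∈ = proj₁ (∧⁻ x∈) , λ { refl → to T-not⇔¬T (proj₂ (∧⁻ x∈)) (≟-refl x) }

    S′-intro : ∀ {x} → T (S x) → x ≢ v → T (S′ x)
    S′-intro sx x≢v = ∧⁺ sx (from T-not⇔¬T (x≢v ∘ ≟-sound))

    v<S′ : ∀ {x} → T (S′ x) → toℕ v < toℕ x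
    v<S′ x∈ = let sx , x≢v = S′-elim x∈ in ≤∧≢⇒< (v-min sx) (λ v≡x → x≢v (toℕ-injective (sym v≡x)))

    C⊆S′ : ∀ {u x} → T (S′ u) → T (C u x) → T (S′ x)
    C⊆S′ u∈ x∈ = walk-start (component⇒walk G S′ _ u∈ x∈)

    v∉C : ∀ {u} → T (S′ u) → ¬ T (C u v)
    v∉C u∈ v∈ = proj₂ (S′-elim (C⊆S′ u∈ v∈)) refl

    neighbour-unique : ∀ {u u′ x} → T (nbrᵇ u) → T (nbrᵇ u′) → T (C u x) → T (C u′ x) → u ≡ u′
    neighbour-unique {u} {u′} nu nu′ x∈ x∈′ with u ≟ u′
    ... | yes u≡u′ = u≡u′
    ... | no u≢u′  = ⊥-elim (acyclic⇒no-detour G-sym acyclic (proj₂ (∧⁻ nu)) (proj₂ (∧⁻ nu′)) u≢u′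
        (mapʷ (proj₂ ∘ S′-elim) (reverseʷ G-sym (component⇒walk G S′ u (proj₁ (∧⁻ nu)) x∈)
                                 ++ʷ component⇒walk G S′ u′ (proj₁ (∧⁻ nu′)) x∈′)))

    neighbour-before-v : ∀ {x} → WalkWithin G (T ∘ S) x v → x ≢ v → ∃[ u ] T (nbrᵇ u) × WalkWithin G (T ∘ S′) x u
    neighbour-before-v (end _)                       x≢v = ⊥-elim (x≢v refl)
    neighbour-before-v (_∷⟨_⟩_ {x = x} {y} sx e w) x≢v with y ≟ v
    ... | yes refl = x , ∧⁺ (S′-intro sx x≢v) (G-sym e) , end (S′-intro sx x≢v)
    ... | no y≢v   = let u , nu , w′ = neighbour-before-v w y≢v in u , nu , S′-intro sx x≢v ∷⟨ e ⟩ w′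

    S′-covered : ∀ {x} → T (S′ x) → ∃[ u ] T (nbrᵇ u) × T (C u x)
    S′-covered x∈ = let sx , x≢v = S′-elim x∈ ; u , nu , w = neighbour-before-v (connected sx v∈S) x≢v
               in u , nu , walk⇒component G S′ u w

    C-connected : ∀ {u} → T (S′ u) → ConnectedOn (C u)
    C-connected {u} u∈ x∈ y∈ =
      mapʷ proj₁ (walk-within-component G S′ u u∈ {Q = λ _ → ⊤}
        (mapʷ (_, tt) (component⇒walk G S′ u u∈ x∈ ++ʷ reverseʷ G-sym (component⇒walk G S′ u u∈ y∈))) y∈)

    active-at-v⇔ : ∀ b → T (activeᵇ S v b) ⇔ (∃[ u ] T (nbrᵇ u ∧ countedᵇ u b))
    active-at-v⇔ b = mk⇔ (⇒ ∘ to (activeᵇ⇔Active S v b)) ⇐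
      where
      ⇒ : Active S v b → ∃[ u ] T (nbrᵇ u ∧ countedᵇ u b)
      ⇒ (_ , _ , tvb , _ , N , vN , b<N , w) =
        N , ∧⁺ (∧⁺ N∈S′ vN) (∧⁺ (walk⇒component G S′ N (reverseʷ G-sym w′)) (∧⁺ (<⇒<ᵇ tvb) (<⇒<ᵇ b<N)))
        where
        N∈S′ : T (S′ N)
        N∈S′ = S′-intro (proj₁ (walk-start w)) (λ N≡v → loopless v (subst (Adj G v) N≡v vN))
        w′ : WalkWithin G (T ∘ S′) N b
        w′ = mapʷ (λ (sz , v<z) → S′-intro sz (>⇒≢ v<z)) w
      ⇐ : ∃[ u ] T (nbrᵇ u ∧ countedᵇ u b) → T (activeᵇ S v b)
      ⇐ (u , h) =
        let nu , counted = ∧⁻ h ; u∈S′ , vu = ∧⁻ nu ; Cub , h₁ = ∧⁻ counted ; tvb , b<u = ∧⁻ h₁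
            b∈S′ = C⊆S′ u∈S′ Cub
            ¬vb : ¬ Adj G v b
            ¬vb vb = <-irrefl (cong toℕ (neighbour-unique (∧⁺ b∈S′ vb) nu (walk⇒component G S′ b (end b∈S′)) Cub))
                              (<ᵇ⇒< _ _ b<u)
        in from (activeᵇ⇔Active S v b)
             (v∈S , (proj₁ (S′-elim b∈S′) , v<S′ b∈S′) , <ᵇ⇒< _ _ tvb , ¬vb , u , vu , <ᵇ⇒< _ _ b<u ,
              mapʷ (λ z∈ → proj₁ (S′-elim z∈) , v<S′ z∈) (reverseʷ G-sym (component⇒walk G S′ u u∈S′ Cub)))

    active-off-v⇔ : ∀ {a b} → a ≢ v → T (activeᵇ S a b) ⇔ (∃[ u ] T (nbrᵇ u ∧ activeᵇ (C u) a b))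
    active-off-v⇔ {a} {b} a≢v = mk⇔ (⇒ ∘ to (activeᵇ⇔Active S a b)) ⇐
      where
      ⇒ : Active S a b → ∃[ u ] T (nbrᵇ u ∧ activeᵇ (C u) a b)
      ⇒ (sa , (_ , a<b) , tab , ¬ab , N , aN , b<N , w) with u , nu , Cua ← S′-covered (S′-intro sa a≢v) =
        u , ∧⁺ nu (from (activeᵇ⇔Active (C u) a b)
                    (Cua , (proj₁ (walk-end wC) , a<b) , tab , ¬ab , N , aN , b<N , wC))
        where
        u∈S′ : T (S′ u)
        u∈S′ = proj₁ (∧⁻ nu)
        S′-above-a : ∀ {z} → Above S a z → T (S′ z)
        S′-above-a (sz , a<z) = S′-intro sz (>⇒≢ (≤-<-trans (v-min sa) a<z))
        CuN : T (C u N)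
        CuN = walk⇒component G S′ u (S′-above-a (walk-start w) ∷⟨ G-sym aN ⟩ component⇒walk G S′ u u∈S′ Cua)
        wC : WalkWithin G (Above (C u) a) N b
        wC = reverseʷ G-sym (walk-within-component G S′ u u∈S′
               (reverseʷ G-sym (mapʷ (λ z∈ → S′-above-a z∈ , proj₂ z∈) w)) CuN)
      ⇐ : ∃[ u ] T (nbrᵇ u ∧ activeᵇ (C u) a b) → T (activeᵇ S a b)
      ⇐ (u , h) = let nu , act = ∧⁻ {nbrᵇ u} h in
        from (activeᵇ⇔Active S a b) (Active-C⇒S (proj₁ (∧⁻ nu)) (to (activeᵇ⇔Active (C u) a b) act))
        where
        Active-C⇒S : ∀ {u} → T (S′ u) → Active (C u) a b → Active S a b
        Active-C⇒S u∈S′ (Cua , (Cub , a<b) , tab , ¬ab , N , aN , b<N , w) =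
          C⊆S Cua , (C⊆S Cub , a<b) , tab , ¬ab , N , aN , b<N , mapʷ (λ (cz , a<z) → C⊆S cz , a<z) w
          where
          C⊆S : ∀ {x} → T (C _ x) → T (S x)
          C⊆S = proj₁ ∘ S′-elim ∘ C⊆S′ u∈S′

    counted-unique : ∀ {b u u′} → T (nbrᵇ u ∧ countedᵇ u b) → T (nbrᵇ u′ ∧ countedᵇ u′ b) → u ≡ u′
    counted-unique {b} {u} {u′} h h′ =
      neighbour-unique (proj₁ (∧⁻ {nbrᵇ u} h)) (proj₁ (∧⁻ {nbrᵇ u′} h′))
                 (proj₁ (∧⁻ {C u b} (proj₂ (∧⁻ {nbrᵇ u} h)))) (proj₁ (∧⁻ {C u′ b} (proj₂ (∧⁻ {nbrᵇ u′} h′))))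

    owner-unique : ∀ {a b u u′} → T (nbrᵇ u ∧ activeᵇ (C u) a b) → T (nbrᵇ u′ ∧ activeᵇ (C u′) a b) → u ≡ u′
    owner-unique {a} {b} {u} {u′} h h′ =
      neighbour-unique (proj₁ (∧⁻ {nbrᵇ u} h)) (proj₁ (∧⁻ {nbrᵇ u′} h′))
                 (proj₁ (∧⁻ {C u a} (proj₂ (∧⁻ {nbrᵇ u} h)))) (proj₁ (∧⁻ {C u′ a} (proj₂ (∧⁻ {nbrᵇ u′} h′))))

    private
      counting : Fin n → ℕ
      counting b = sum (λ u → 𝟙 (nbrᵇ u ∧ countedᵇ u b))

      activeInComponents : Fin n → Fin n → ℕ
      activeInComponents a b = sum (λ u → 𝟙 (nbrᵇ u ∧ activeᵇ (C u) a b))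

      atV : Fin n → Fin n → ℕ
      atV a b = if ⌊ a ≟ v ⌋ then counting b else 0

      v-owns-nothing : ∀ b u → 𝟙 (nbrᵇ u ∧ activeᵇ (C u) v b) ≡ 0
      v-owns-nothing b u =
        𝟙-false λ h → v∉C (proj₁ (∧⁻ (proj₁ (∧⁻ {nbrᵇ u} h)))) (proj₁ (∧⁻ {C u v} (proj₂ (∧⁻ {nbrᵇ u} h))))

      𝟙-active-split : ∀ a b → 𝟙 (activeᵇ S a b) ≡ atV a b + activeInComponents a b
      𝟙-active-split a b with a ≟ v
      ... | yes refl = begin
        𝟙 (activeᵇ S v b)                       ≡⟨ 𝟙-∃! _ (λ u → nbrᵇ u ∧ countedᵇ u b) (active-at-v⇔ b) counted-unique ⟩
        counting b                              ≡⟨ +-identityʳ (counting b) ⟨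
        counting b + 0                          ≡⟨ cong (counting b +_) (∑-zero (v-owns-nothing b)) ⟨
        counting b + activeInComponents v b     ∎
        where open ≡-Reasoning
      ... | no a≢v = 𝟙-∃! _ (λ u → nbrᵇ u ∧ activeᵇ (C u) a b) (active-off-v⇔ a≢v) owner-unique

    counted : Fin n → ℕ
    counted u = sum (𝟙 ∘ countedᵇ u)

    activeCount-step : activeCount S ≡ sum (λ u → if nbrᵇ u then counted u + activeCount (C u) else 0)
    activeCount-step = begin
      sum (λ a → sum (λ b → 𝟙 (activeᵇ S a b)))
        ≡⟨ sum-cong-≗ (λ a → trans (sum-cong-≗ (𝟙-active-split a)) (∑-distrib-+ (atV a) (activeInComponents a))) ⟩
      sum (λ a → sum (atV a) + sum (activeInComponents a))
        ≡⟨ ∑-distrib-+ (λ a → sum (atV a)) (λ a → sum (activeInComponents a)) ⟩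
      sum (λ a → sum (atV a)) + sum (λ a → sum (activeInComponents a))
        ≡⟨ cong₂ _+_ row-v other-rows ⟩
      sum (guarded counted) + sum (guarded (activeCount ∘ C))
        ≡⟨ ∑-distrib-+ (guarded counted) (guarded (activeCount ∘ C)) ⟨
      sum (λ u → guarded counted u + guarded (activeCount ∘ C) u)
        ≡⟨ sum-cong-≗ (λ u → if-+ (nbrᵇ u) _ _) ⟩
      sum (λ u → if nbrᵇ u then counted u + activeCount (C u) else 0) ∎
      where
      open ≡-Reasoning
      guarded : (Fin n → ℕ) → Fin n → ℕ
      guarded f u = if nbrᵇ u then f u else 0
      row-v : sum (λ a → sum (atV a)) ≡ sum (guarded counted)
      row-v = begin
        sum (λ a → sum (atV a))                            ≡⟨ sum-cong-≗ (λ a → ∑-if ⌊ a ≟ v ⌋ counting) ⟩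
        sum (λ a → if ⌊ a ≟ v ⌋ then sum counting else 0) ≡⟨ ∑-if-≟ v (sum counting) ⟩
        sum counting                                       ≡⟨ ∑-comm (λ b u → 𝟙 (nbrᵇ u ∧ countedᵇ u b)) ⟩
        sum (λ u → sum (λ b → 𝟙 (nbrᵇ u ∧ countedᵇ u b)))  ≡⟨ sum-cong-≗ (λ u → ∑𝟙-∧ (nbrᵇ u) (countedᵇ u)) ⟩
        sum (guarded counted)                              ∎
      other-rows : sum (λ a → sum (activeInComponents a)) ≡ sum (guarded (activeCount ∘ C))
      other-rows = begin
        sum (λ a → sum (λ b → sum (λ u → 𝟙 (nbrᵇ u ∧ activeᵇ (C u) a b))))
          ≡⟨ sum-cong-≗ (λ a → ∑-comm (λ b u → 𝟙 (nbrᵇ u ∧ activeᵇ (C u) a b))) ⟩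
        sum (λ a → sum (λ u → sum (λ b → 𝟙 (nbrᵇ u ∧ activeᵇ (C u) a b))))
          ≡⟨ ∑-comm (λ a u → sum (λ b → 𝟙 (nbrᵇ u ∧ activeᵇ (C u) a b))) ⟩
        sum (λ u → sum (λ a → sum (λ b → 𝟙 (nbrᵇ u ∧ activeᵇ (C u) a b))))
          ≡⟨ sum-cong-≗ (λ u → trans (sum-cong-≗ (λ a → ∑𝟙-∧ (nbrᵇ u) (activeᵇ (C u) a)))
                                     (∑-if (nbrᵇ u) (λ a → sum (λ b → 𝟙 (activeᵇ (C u) a b))))) ⟩
        sum (guarded (activeCount ∘ C)) ∎

  activeCount-empty : ∀ S → (∀ x → ¬ T (S x)) → activeCount S ≡ 0
  activeCount-empty S empty =
    ∑-zero (λ a → ∑-zero {f = λ b → 𝟙 (activeᵇ S a b)} (λ b → 𝟙-false (empty a ∘ proj₁ ∘ ∧⁻ {S a})))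

  -- k is the fuel of weightOn; the bound says that the vertices of S lie in {n − k, …, n − 1}.
  activeCount≡weightOn : ∀ k S → (∀ {x} → T (S x) → n ≤ toℕ x + k) → ConnectedOn S →
                         activeCount S ≡ weightOn G t k S
  activeCount≡weightOn zero    S bound _ =
    activeCount-empty S (λ x sx → <⇒≱ (toℕ<n x) (subst (n ≤_) (+-identityʳ (toℕ x)) (bound sx)))
  activeCount≡weightOn (suc k) S bound connected with firstTrue S in first
  ... | nothing = activeCount-empty S (firstTrue-nothing S first)
  ... | just v  = trans activeCount-step (trans (sum-cong-≗ component-term) (sym (sumˡ-allFin contribution)))
    where
    v∈S : T (S v)
    v∈S = proj₁ (firstTrue-just S first)
    open Step S v v∈S (proj₂ (firstTrue-just S first)) connected
    contribution : Fin n → ℕ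
    contribution u = if nbrᵇ u then count (countedᵇ u) + weightOn G t k (C u) else 0
    component-term : ∀ u → (if nbrᵇ u then counted u + activeCount (C u) else 0) ≡ contribution u
    component-term u with nbrᵇ u in nbr
    ... | false = refl
    ... | true  = cong₂ _+_ (sym (sumˡ-allFin (𝟙 ∘ countedᵇ u)))
                            (activeCount≡weightOn k (C u) bound′ (C-connected u∈S′))
      where
      u∈S′ : T (S′ u)
      u∈S′ = proj₁ (∧⁻ {S′ u} (subst T (sym nbr) tt))
      bound′ : ∀ {x} → T (C u x) → n ≤ toℕ x + k
      bound′ {x} x∈ =
        ≤-trans (bound v∈S) (subst (_≤ toℕ x + k) (sym (+-suc (toℕ v) k)) (+-monoˡ-≤ k (v<S′ (C⊆S′ u∈S′ x∈))))

theorem2p7 : (n m : ℕ) → 1 ≤ n → 2 ≤ m → (T : Graph n) → (t : Fin n → Fin m) →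
    IsTieredTree T t → externalActivity-is T t (weight T t)
theorem2p7 n m _ _ G t (((symmetric , loopless) , connected , acyclic) , _) =
  subst (externalActivity-is G t) activeCount≡weight
    (hasCount-∑𝟙 (activeᵇ everything) λ a b →
      ⇔-trans (activeᵇ⇔Active everything a b) (⇔-sym (externallyActive⇔Active G-sym acyclic connected a b)))
  where
  G-sym : Symmetric (Adj G)
  G-sym {x} {y} = subst T (symmetric x y)
  everything : Fin n → Bool
  everything _ = true
  open Activity G t
  open WeightRecursion G t G-sym (λ x → subst T (loopless x)) acyclic
  activeCount≡weight : activeCount everything ≡ weight G t
  activeCount≡weight =
    activeCount≡weightOn n everything (λ {x} _ → m≤n+m n (toℕ x)) (λ {x} {y} _ _ → fromWalk (connected x y))
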